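{- If $M_1$ and $M_2$ are equivalent $\mathbb{H}$-representations (of the same matroid), then $M_1M_1^{\mathrm H}$ and $M_2M_2^{\mathrm H}$ have the same Smith normal form over $\mathcal{E}$ (i.e. the same elementary divisors up to units).
   Context: $\omega=e^{2\pi i/6}$, $\mathcal{E}=\mathbb{Z}[\omega]$ (a PID), $\mathbb{H}=\{z\in\mathbb{C}:z^6=1\}\cup\{0\}$. An $\mathbb{H}$-matrix is a complex matrix all of whose square subdeterminants lie in $\mathbb{H}$; an $\mathbb{H}$-representation of a matroid is an $\mathbb{H}$-matrix representing it over $\mathbb{C}$. $M^{\mathrm H}$ is the conjugate transpose. Two $\mathbb{H}$-representations are equivalent if one is obtained from the other by a sequence of: multiplying a row or a column by a sixth root of unity; interchanging two rows; interchanging two columns (together with their labels); pivoting on a nonzero entry. Smith normal form over $\mathcal{E}$: for a nonzero matrix $A$ of rank $k$, invertible $S,T$ over $\mathcal{E}$ with $SAT$ diagonal $(\alpha_1,\dots,\alpha_k,0,\dots,0)$, $\alpha_i\mid\alpha_{i+1}$, the $\alpha_i$ unique up to units. -}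

module Defs where

open import Data.Nat using (ℕ; zero; suc)
open import Data.Integer as ℤ using (ℤ; +_; -_)
open import Data.Fin as Fin using (Fin; zero; suc; punchIn; _≟_)
open import Data.Product using (Σ; ∃; _×_; _,_)
open import Data.Sum using (_⊎_)
open import Relation.Nullary using (¬_; yes; no)
open import Relation.Binary.PropositionalEquality using (_≡_)
open import Relation.Binary.Construct.Closure.Equivalence using (EqClosure)
open import Function.Definitions using (Injective)
open import Function.Bundles using (_⇔_)

-- Eisenstein integers  ℰ = ℤ[ω],  ω = e^{2πi/6},  ω² = ω - 1.
-- The element  re + im·ω  is written  ⟨ re , im ⟩.

record ℰ : Set where
  constructor ⟨_,_⟩
  field
    re : ℤ
    im : ℤ
open ℰ public

0ℰ 1ℰ ω : ℰ
0ℰ = ⟨ + 0 , + 0 ⟩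
1ℰ = ⟨ + 1 , + 0 ⟩
ω  = ⟨ + 0 , + 1 ⟩

infixl 6 _+ℰ_ _-ℰ_
infixl 7 _*ℰ_

_+ℰ_ : ℰ → ℰ → ℰ
⟨ a , b ⟩ +ℰ ⟨ c , d ⟩ = ⟨ a ℤ.+ c , b ℤ.+ d ⟩

-ℰ_ : ℰ → ℰ
-ℰ ⟨ a , b ⟩ = ⟨ - a , - b ⟩

_-ℰ_ : ℰ → ℰ → ℰ
x -ℰ y = x +ℰ (-ℰ y)

-- (a + bω)(c + dω) = (ac - bd) + (ad + bc + bd)ω   using ω² = ω - 1
_*ℰ_ : ℰ → ℰ → ℰ
⟨ a , b ⟩ *ℰ ⟨ c , d ⟩ =
  ⟨ a ℤ.* c ℤ.- b ℤ.* d , a ℤ.* d ℤ.+ b ℤ.* c ℤ.+ b ℤ.* d ⟩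

-- complex conjugation: conj ω = ω⁵ = 1 - ω
conj : ℰ → ℰ
conj ⟨ a , b ⟩ = ⟨ a ℤ.+ b , - b ⟩

_^ℰ_ : ℰ → ℕ → ℰ
x ^ℰ zero  = 1ℰ
x ^ℰ suc n = x *ℰ (x ^ℰ n)

_∣ℰ_ : ℰ → ℰ → Set
a ∣ℰ b = ∃ λ c → b ≡ c *ℰ a

Inℍ : ℰ → Set
Inℍ z = (z ^ℰ 6 ≡ 1ℰ) ⊎ (z ≡ 0ℰ)

Matrix : ℕ → ℕ → Set
Matrix m n = Fin m → Fin n → ℰ

sumℰ : ∀ {n} → (Fin n → ℰ) → ℰ
sumℰ {zero}  f = 0ℰ
sumℰ {suc n} f = f zero +ℰ sumℰ (λ i → f (suc i))

infixl 7 _⊗_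
infix 4 _≐_
_⊗_ : ∀ {m n p} → Matrix m n → Matrix n p → Matrix m p
(A ⊗ B) i k = sumℰ (λ j → A i j *ℰ B j k)

_ᴴ : ∀ {m n} → Matrix m n → Matrix n m
(A ᴴ) i j = conj (A j i)

identity : ∀ {n} → Matrix n n
identity i j with i ≟ j
... | yes _ = 1ℰ
... | no  _ = 0ℰ

diag : ∀ {n} → (Fin n → ℰ) → Matrix n n
diag d i j with i ≟ j
... | yes _ = d i
... | no  _ = 0ℰ

_≐_ : ∀ {m n} → Matrix m n → Matrix m n → Set
A ≐ B = ∀ i j → A i j ≡ B i j

sgn : ℕ → ℰ
sgn zero          = 1ℰ
sgn (suc zero)    = -ℰ 1ℰ
sgn (suc (suc n)) = sgn n

det : ∀ {n} → Matrix n n → ℰ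
det {zero}  A = 1ℰ
det {suc n} A =
  sumℰ (λ j → sgn (Fin.toℕ j) *ℰ A zero j *ℰ det (λ i k → A (suc i) (punchIn j k)))

-- ℍ-matrices: every square subdeterminant lies in ℍ.
-- A k×k submatrix is given by injective choices of k rows and k columns.

IsℍMatrix : ∀ {m n} → Matrix m n → Set
IsℍMatrix {m} {n} A =
  ∀ k (f : Fin k → Fin m) (g : Fin k → Fin n) →
  Injective _≡_ _≡_ f → Injective _≡_ _≡_ g →
  Inℍ (det (λ i j → A (f i) (g j)))

swapFin : ∀ {n} → Fin n → Fin n → Fin n → Fin n
swapFin i j k with k ≟ i
... | yes _ = j
... | no  _ with k ≟ j
...   | yes _ = i
...   | no  _ = k

scaleRow : ∀ {m n} → Fin m → ℰ → Matrix m n → Matrix m n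
scaleRow i u A k l with k ≟ i
... | yes _ = u *ℰ A k l
... | no  _ = A k l

scaleCol : ∀ {m n} → Fin n → ℰ → Matrix m n → Matrix m n
scaleCol j u A k l with l ≟ j
... | yes _ = A k l *ℰ u
... | no  _ = A k l

swapRows : ∀ {m n} → Fin m → Fin m → Matrix m n → Matrix m n
swapRows i i' A k l = A (swapFin i i' k) l

swapCols : ∀ {m n} → Fin n → Fin n → Matrix m n → Matrix m n
swapCols j j' A k l = A k (swapFin j j' l)

-- B is obtained from A by pivoting on the nonzero entry A i j:
-- row i is divided by A i j (so B i j = 1) and then A k j · (new row i)
-- is subtracted from every other row k, making column j the i-th unit vector.
IsPivot : ∀ {m n} → Matrix m n → Fin m → Fin n → Matrix m n → Set
IsPivot A i j B =
  ¬ (A i j ≡ 0ℰ) ×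
  (∀ l → A i j *ℰ B i l ≡ A i l) ×
  (∀ k → ¬ (k ≡ i) → ∀ l → B k l ≡ A k l -ℰ A k j *ℰ B i l)

data Step {m n} : Matrix m n → Matrix m n → Set where
  rowScale : ∀ A i u → u ^ℰ 6 ≡ 1ℰ → Step A (scaleRow i u A)
  colScale : ∀ A j u → u ^ℰ 6 ≡ 1ℰ → Step A (scaleCol j u A)
  rowSwap  : ∀ A i i' → Step A (swapRows i i' A)
  colSwap  : ∀ A j j' → Step A (swapCols j j' A)
  pivot    : ∀ A i j B → IsPivot A i j B → Step A B

ℍStep : ∀ {m n} → Matrix m n → Matrix m n → Set
ℍStep A B = IsℍMatrix A × IsℍMatrix B × Step A B

Equivalentℍ : ∀ {m n} → Matrix m n → Matrix m n → Set
Equivalentℍ = EqClosure ℍStep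

Invertible : ∀ {n} → Matrix n n → Set
Invertible {n} S = Σ (Matrix n n) λ S' → (S ⊗ S' ≐ identity) × (S' ⊗ S ≐ identity)

-- diag d is a Smith normal form of A: S A T = diag d with S, T invertible
-- over ℰ and d i ∣ d j whenever i ≤ j (this forces the zero entries to come
-- last, and the nonzero ones α₁ ∣ α₂ ∣ … ∣ α_k to come first).
IsSNF : ∀ {n} → Matrix n n → (Fin n → ℰ) → Set
IsSNF {n} A d =
  Σ (Matrix n n) λ S → Σ (Matrix n n) λ T →
  Invertible S × Invertible T × ((S ⊗ A) ⊗ T ≐ diag d) ×
  (∀ i j → i Fin.≤ j → d i ∣ℰ d j)

-- A row operation replaces M by E M with E invertible over ℰ, and so replaces the Gram
-- matrix M Mᴴ by E (M Mᴴ) Eᴴ.  Row scalings, row swaps and pivots are all of this form; for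
-- a pivot on an entry c, E is invertible over ℰ because in an ℍ-matrix c is a sixth root of
-- unity, so 1/c = c⁵ lies in ℰ.  A column scaling by a sixth root of unity u, or a column
-- swap, leaves M Mᴴ unchanged, because u ū = 1 and the entries of M Mᴴ are sums over the
-- columns.  So the Gram matrices of equivalent ℍ-representations are equivalent over ℰ
-- (Y = P X Q with P, Q invertible), and a Smith normal form of one is one of the other.
module Submission where

open import Defs
open import Data.Nat using (ℕ; zero; suc; z≤n) renaming (_*_ to _*ℕ_)
import Data.Nat.Properties as ℕ
open import Data.Integer
  using (ℤ; +_; -[1+_]; +[1+_]; -_; 0ℤ; 1ℤ; _+_; _*_; _-_; ∣_∣; _≤_; +≤+)
import Data.Integer.Properties as ℤ
import Data.Integer.Tactic.RingSolver as ℤ-Solver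
open import Data.Fin using (Fin; zero; suc; punchIn; _≟_)
open import Data.Fin.Properties using (punchInᵢ≢i)
import Data.Fin.Permutation as Perm
open import Data.Fin.Permutation using (Permutation; _⟨$⟩ʳ_)
import Data.Fin.Permutation.Components as PermComponents
open import Data.List using (_∷_; [])
open import Data.Maybe using (Maybe; just; nothing)
open import Data.Product using (Σ; _×_; _,_; proj₁)
open import Data.Sum using (inj₁; inj₂)
open import Function using (_∘_)
open import Function.Bundles using (_⇔_; mk⇔)
open import Function.Definitions using (Injective)
open import Relation.Nullary using (Dec; yes; no; contradiction)
open import Relation.Binary.PropositionalEquality
  using (_≡_; _≢_; refl; sym; trans; cong; cong₂; subst; isEquivalence; module ≡-Reasoning)
open import Relation.Binary.Bundles using (Setoid)
open import Relation.Binary.Structures using (IsEquivalence)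
open import Relation.Binary.Construct.Closure.Equivalence using (gfold)
import Relation.Binary.Reasoning.Setoid as SetoidReasoning
open import Algebra.Bundles using (CommutativeRing; Monoid)
open import Algebra.Definitions {A = ℰ} _≡_
  using (Associative; Commutative; LeftIdentity; LeftInverse; _DistributesOverˡ_)
open import Algebra.Structures {A = ℰ} _≡_ using (IsCommutativeRing)
open import Algebra.Consequences.Propositional {A = ℰ}
  using (comm∧idˡ⇒id; comm∧invˡ⇒inv; comm∧distrˡ⇒distrʳ)
import Algebra.Properties.Monoid as MonoidProperties
open import Tactic.RingSolver using (solve)
open import Tactic.RingSolver.Core.AlmostCommutativeRing
  using (AlmostCommutativeRing; fromCommutativeRing)

+ℰ-assoc : Associative _+ℰ_
+ℰ-assoc ⟨ a , b ⟩ ⟨ c , d ⟩ ⟨ e , f ⟩ = cong₂ ⟨_,_⟩ (ℤ.+-assoc a c e) (ℤ.+-assoc b d f)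

+ℰ-comm : Commutative _+ℰ_
+ℰ-comm ⟨ a , b ⟩ ⟨ c , d ⟩ = cong₂ ⟨_,_⟩ (ℤ.+-comm a c) (ℤ.+-comm b d)

+ℰ-identityˡ : LeftIdentity 0ℰ _+ℰ_
+ℰ-identityˡ ⟨ a , b ⟩ = cong₂ ⟨_,_⟩ (ℤ.+-identityˡ a) (ℤ.+-identityˡ b)

-ℰ-inverseˡ : LeftInverse 0ℰ (-ℰ_) _+ℰ_
-ℰ-inverseˡ ⟨ a , b ⟩ = cong₂ ⟨_,_⟩ (ℤ.+-inverseˡ a) (ℤ.+-inverseˡ b)

-- The integer solver does not unfold _*ℰ_, so the components are spelled out.
*ℰ-assoc : Associative _*ℰ_
*ℰ-assoc ⟨ a , b ⟩ ⟨ c , d ⟩ ⟨ e , f ⟩ = cong₂ ⟨_,_⟩ re-assoc im-assoc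
  where
  re-assoc : (a * c - b * d) * e - (a * d + b * c + b * d) * f
           ≡ a * (c * e - d * f) - b * (c * f + d * e + d * f)
  re-assoc = ℤ-Solver.solve (a ∷ b ∷ c ∷ d ∷ e ∷ f ∷ [])
  im-assoc : (a * c - b * d) * f + (a * d + b * c + b * d) * e + (a * d + b * c + b * d) * f
           ≡ a * (c * f + d * e + d * f) + b * (c * e - d * f) + b * (c * f + d * e + d * f)
  im-assoc = ℤ-Solver.solve (a ∷ b ∷ c ∷ d ∷ e ∷ f ∷ [])

*ℰ-comm : Commutative _*ℰ_
*ℰ-comm ⟨ a , b ⟩ ⟨ c , d ⟩ = cong₂ ⟨_,_⟩ re-comm im-comm
  where
  re-comm : a * c - b * d ≡ c * a - d * b
  re-comm = ℤ-Solver.solve (a ∷ b ∷ c ∷ d ∷ [])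
  im-comm : a * d + b * c + b * d ≡ c * b + d * a + d * b
  im-comm = ℤ-Solver.solve (a ∷ b ∷ c ∷ d ∷ [])

*ℰ-identityˡ : LeftIdentity 1ℰ _*ℰ_
*ℰ-identityˡ ⟨ a , b ⟩ = cong₂ ⟨_,_⟩ re-identity im-identity
  where
  re-identity : + 1 * a - + 0 * b ≡ a
  re-identity = ℤ-Solver.solve (a ∷ b ∷ [])
  im-identity : + 1 * b + + 0 * a + + 0 * b ≡ b
  im-identity = ℤ-Solver.solve (a ∷ b ∷ [])

*ℰ-distribˡ-+ℰ : _*ℰ_ DistributesOverˡ _+ℰ_
*ℰ-distribˡ-+ℰ ⟨ a , b ⟩ ⟨ c , d ⟩ ⟨ e , f ⟩ = cong₂ ⟨_,_⟩ re-distrib im-distrib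
  where
  re-distrib : a * (c + e) - b * (d + f) ≡ (a * c - b * d) + (a * e - b * f)
  re-distrib = ℤ-Solver.solve (a ∷ b ∷ c ∷ d ∷ e ∷ f ∷ [])
  im-distrib : a * (d + f) + b * (c + e) + b * (d + f)
             ≡ (a * d + b * c + b * d) + (a * f + b * e + b * f)
  im-distrib = ℤ-Solver.solve (a ∷ b ∷ c ∷ d ∷ e ∷ f ∷ [])

ℰ-isCommutativeRing : IsCommutativeRing _+ℰ_ _*ℰ_ (-ℰ_) 0ℰ 1ℰ
ℰ-isCommutativeRing = record
  { isRing = record
    { +-isAbelianGroup = record
      { isGroup = record
        { isMonoid = record
          { isSemigroup = record
            { isMagma = record { isEquivalence = isEquivalence ; ∙-cong = cong₂ _+ℰ_ }
            ; assoc = +ℰ-assoc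
            }
          ; identity = comm∧idˡ⇒id +ℰ-comm +ℰ-identityˡ
          }
        ; inverse = comm∧invˡ⇒inv +ℰ-comm -ℰ-inverseˡ
        ; ⁻¹-cong = cong (-ℰ_)
        }
      ; comm = +ℰ-comm
      }
    ; *-cong = cong₂ _*ℰ_
    ; *-assoc = *ℰ-assoc
    ; *-identity = comm∧idˡ⇒id *ℰ-comm *ℰ-identityˡ
    ; distrib = *ℰ-distribˡ-+ℰ , comm∧distrˡ⇒distrʳ *ℰ-comm *ℰ-distribˡ-+ℰ
    }
  ; *-comm = *ℰ-comm
  }

ℰ-commutativeRing : CommutativeRing _ _
ℰ-commutativeRing = record { isCommutativeRing = ℰ-isCommutativeRing }

ℰ-ring : AlmostCommutativeRing _ _
ℰ-ring = fromCommutativeRing ℰ-commutativeRing 0ℰ≟_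
  where
  0ℰ≟_ : ∀ x → Maybe (0ℰ ≡ x)
  0ℰ≟ ⟨ + 0 , + 0 ⟩ = just refl
  0ℰ≟ _             = nothing

open CommutativeRing ℰ-commutativeRing
  using (+-identityʳ; *-identityˡ; *-identityʳ; zeroˡ; zeroʳ; *-assoc; *-comm; distribʳ; semiring)
open import Algebra.Properties.Semiring.Sum semiring
  using (sum; sum-cong-≗; sum-remove; sum-replicate-zero; sum-permute; ∑-comm; ∑-distrib-+;
         *-distribˡ-sum; *-distribʳ-sum)

conj-+ : ∀ x y → conj (x +ℰ y) ≡ conj x +ℰ conj y
conj-+ ⟨ a , b ⟩ ⟨ c , d ⟩ = cong₂ ⟨_,_⟩ re-conj (ℤ.neg-distrib-+ b d)
  where
  re-conj : (a + c) + (b + d) ≡ (a + b) + (c + d)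
  re-conj = ℤ-Solver.solve (a ∷ b ∷ c ∷ d ∷ [])

conj-* : ∀ x y → conj (x *ℰ y) ≡ conj x *ℰ conj y
conj-* ⟨ a , b ⟩ ⟨ c , d ⟩ = cong₂ ⟨_,_⟩ re-conj im-conj
  where
  re-conj : (a * c - b * d) + (a * d + b * c + b * d) ≡ (a + b) * (c + d) - (- b) * (- d)
  re-conj = ℤ-Solver.solve (a ∷ b ∷ c ∷ d ∷ [])
  im-conj : - (a * d + b * c + b * d) ≡ (a + b) * (- d) + (- b) * (c + d) + (- b) * (- d)
  im-conj = ℤ-Solver.solve (a ∷ b ∷ c ∷ d ∷ [])

norm : ℰ → ℤ
norm ⟨ a , b ⟩ = a * a + a * b + b * b

norm-* : ∀ x y → norm (x *ℰ y) ≡ norm x * norm y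
norm-* ⟨ a , b ⟩ ⟨ c , d ⟩ = multiplicative
  where
  multiplicative : (a * c - b * d) * (a * c - b * d) + (a * c - b * d) * (a * d + b * c + b * d)
                     + (a * d + b * c + b * d) * (a * d + b * c + b * d)
                 ≡ (a * a + a * b + b * b) * (c * c + c * d + d * d)
  multiplicative = ℤ-Solver.solve (a ∷ b ∷ c ∷ d ∷ [])

*-conj : ∀ x → x *ℰ conj x ≡ ⟨ norm x , 0ℤ ⟩
*-conj ⟨ a , b ⟩ = cong₂ ⟨_,_⟩ re-norm im-norm
  where
  re-norm : a * (a + b) - b * (- b) ≡ a * a + a * b + b * b
  re-norm = ℤ-Solver.solve (a ∷ b ∷ [])
  im-norm : a * (- b) + b * (a + b) + b * (- b) ≡ 0ℤ
  im-norm = ℤ-Solver.solve (a ∷ b ∷ [])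

square-nonneg : ∀ i → 0ℤ ≤ i * i
square-nonneg (+ zero) = +≤+ z≤n
square-nonneg +[1+ n ] = +≤+ z≤n
square-nonneg -[1+ n ] = +≤+ z≤n

-- 4 (a² + ab + b²) = (2a + b)² + 3b²
norm-nonneg : ∀ x → 0ℤ ≤ norm x
norm-nonneg ⟨ a , b ⟩ = ℤ.*-cancelˡ-≤-pos 0ℤ (norm ⟨ a , b ⟩) (+ 4) (begin
  0ℤ                                                      ≤⟨ sum-of-squares ⟩
  (+ 2 * a + b) * (+ 2 * a + b) + (b * b + b * b + b * b) ≡⟨ ℤ-Solver.solve (a ∷ b ∷ []) ⟩
  + 4 * (a * a + a * b + b * b)                           ∎)
  where
  open ℤ.≤-Reasoning
  sum-of-squares : 0ℤ ≤ (+ 2 * a + b) * (+ 2 * a + b) + (b * b + b * b + b * b)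
  sum-of-squares = ℤ.+-mono-≤ (square-nonneg (+ 2 * a + b))
    (ℤ.+-mono-≤ (ℤ.+-mono-≤ (square-nonneg b) (square-nonneg b)) (square-nonneg b))

unit⇒norm≡1 : ∀ {x y} → x *ℰ y ≡ 1ℰ → norm x ≡ 1ℤ
unit⇒norm≡1 {x} {y} xy≡1 = begin
  norm x        ≡⟨ ℤ.0≤i⇒+∣i∣≡i (norm-nonneg x) ⟨
  + ∣ norm x ∣  ≡⟨ cong +_ (ℕ.m*n≡1⇒m≡1 ∣ norm x ∣ ∣ norm y ∣ ∣Nx∣*∣Ny∣≡1) ⟩
  1ℤ            ∎
  where
  open ≡-Reasoning
  Nx*Ny≡1 : norm x * norm y ≡ 1ℤ
  Nx*Ny≡1 = trans (sym (norm-* x y)) (cong norm xy≡1)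
  ∣Nx∣*∣Ny∣≡1 : ∣ norm x ∣ *ℕ ∣ norm y ∣ ≡ 1
  ∣Nx∣*∣Ny∣≡1 = trans (sym (ℤ.abs-* (norm x) (norm y))) (cong ∣_∣ Nx*Ny≡1)

unit⇒*-conj≡1 : ∀ {x y} → x *ℰ y ≡ 1ℰ → x *ℰ conj x ≡ 1ℰ
unit⇒*-conj≡1 {x} {y} xy≡1 = trans (*-conj x) (cong ⟨_, 0ℤ ⟩ (unit⇒norm≡1 {x} {y} xy≡1))

sumℰ≡sum : ∀ {n} (f : Fin n → ℰ) → sumℰ f ≡ sum f
sumℰ≡sum {zero}  f = refl
sumℰ≡sum {suc n} f = cong (f zero +ℰ_) (sumℰ≡sum (f ∘ suc))

sum-single : ∀ {n} {f : Fin n → ℰ} i → (∀ j → j ≢ i → f j ≡ 0ℰ) → sum f ≡ f i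
sum-single {suc n} {f} i vanishes = begin
  sum f                         ≡⟨ sum-remove f ⟩
  f i +ℰ sum (f ∘ punchIn i)    ≡⟨ cong (f i +ℰ_) rest≡0 ⟩
  f i +ℰ 0ℰ                     ≡⟨ +-identityʳ (f i) ⟩
  f i                           ∎
  where
  open ≡-Reasoning
  rest≡0 : sum (f ∘ punchIn i) ≡ 0ℰ
  rest≡0 = trans (sum-cong-≗ {y = λ _ → 0ℰ} (λ k → vanishes (punchIn i k) (punchInᵢ≢i i k)))
                 (sum-replicate-zero n)

conj-sum : ∀ {n} (f : Fin n → ℰ) → conj (sum f) ≡ sum (conj ∘ f)
conj-sum {zero}  f = refl
conj-sum {suc n} f = trans (conj-+ (f zero) (sum (f ∘ suc))) (cong (conj (f zero) +ℰ_) (conj-sum (f ∘ suc)))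

identity-diagonal : ∀ {n} (i : Fin n) → identity i i ≡ 1ℰ
identity-diagonal i with i ≟ i
... | yes _   = refl
... | no i≢i = contradiction refl i≢i

identity-offDiagonal : ∀ {n} {i j : Fin n} → i ≢ j → identity i j ≡ 0ℰ
identity-offDiagonal {i = i} {j} i≢j with i ≟ j
... | yes i≡j = contradiction i≡j i≢j
... | no _    = refl

identityᴴ : ∀ {n} → identity {n} ᴴ ≐ identity
identityᴴ i j with j ≟ i | i ≟ j
... | yes _    | yes _    = refl
... | no _     | no _     = refl
... | yes refl | no i≢i   = contradiction refl i≢i
... | no j≢j   | yes refl = contradiction refl j≢j

≐-isEquivalence : ∀ {m n} → IsEquivalence (_≐_ {m} {n})
≐-isEquivalence = record
  { refl  = λ i j → refl
  ; sym   = λ A≐B i j → sym (A≐B i j)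
  ; trans = λ A≐B B≐C i j → trans (A≐B i j) (B≐C i j)
  }

≐-setoid : ℕ → ℕ → Setoid _ _
≐-setoid m n = record { isEquivalence = ≐-isEquivalence {m} {n} }

⊗-entry : ∀ {m n p} (A : Matrix m n) (B : Matrix n p) i k →
          (A ⊗ B) i k ≡ sum (λ j → A i j *ℰ B j k)
⊗-entry A B i k = sumℰ≡sum (λ j → A i j *ℰ B j k)

⊗-cong : ∀ {m n p} {A A′ : Matrix m n} {B B′ : Matrix n p} → A ≐ A′ → B ≐ B′ → A ⊗ B ≐ A′ ⊗ B′
⊗-cong {A = A} {A′} {B} {B′} A≐A′ B≐B′ i k = begin
  (A ⊗ B) i k                    ≡⟨ ⊗-entry A B i k ⟩
  sum (λ j → A i j *ℰ B j k)     ≡⟨ sum-cong-≗ (λ j → cong₂ _*ℰ_ (A≐A′ i j) (B≐B′ j k)) ⟩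
  sum (λ j → A′ i j *ℰ B′ j k)   ≡⟨ ⊗-entry A′ B′ i k ⟨
  (A′ ⊗ B′) i k                  ∎
  where open ≡-Reasoning

⊗-assoc : ∀ {m n p q} (A : Matrix m n) (B : Matrix n p) (C : Matrix p q) → (A ⊗ B) ⊗ C ≐ A ⊗ (B ⊗ C)
⊗-assoc A B C i l = begin
  ((A ⊗ B) ⊗ C) i l
    ≡⟨ ⊗-entry (A ⊗ B) C i l ⟩
  sum (λ k → (A ⊗ B) i k *ℰ C k l)
    ≡⟨ sum-cong-≗ (λ k → trans (cong (_*ℰ C k l) (⊗-entry A B i k))
                               (*-distribʳ-sum (C k l) (λ j → A i j *ℰ B j k))) ⟩
  sum (λ k → sum (λ j → (A i j *ℰ B j k) *ℰ C k l))
    ≡⟨ ∑-comm (λ k j → (A i j *ℰ B j k) *ℰ C k l) ⟩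
  sum (λ j → sum (λ k → (A i j *ℰ B j k) *ℰ C k l))
    ≡⟨ sum-cong-≗ (λ j → trans (sum-cong-≗ (λ k → *-assoc (A i j) (B j k) (C k l)))
                               (sym (*-distribˡ-sum (A i j) (λ k → B j k *ℰ C k l)))) ⟩
  sum (λ j → A i j *ℰ sum (λ k → B j k *ℰ C k l))
    ≡⟨ sum-cong-≗ (λ j → cong (A i j *ℰ_) (⊗-entry B C j l)) ⟨
  sum (λ j → A i j *ℰ (B ⊗ C) j l)
    ≡⟨ ⊗-entry A (B ⊗ C) i l ⟨
  (A ⊗ (B ⊗ C)) i l
    ∎
  where open ≡-Reasoning

⊗-identityˡ : ∀ {m n} (A : Matrix m n) → identity ⊗ A ≐ A
⊗-identityˡ A i k = begin
  (identity ⊗ A) i k                   ≡⟨ ⊗-entry identity A i k ⟩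
  sum (λ j → identity i j *ℰ A j k)    ≡⟨ sum-single i off-diagonal ⟩
  identity i i *ℰ A i k                ≡⟨ cong (_*ℰ A i k) (identity-diagonal i) ⟩
  1ℰ *ℰ A i k                          ≡⟨ *-identityˡ (A i k) ⟩
  A i k                                ∎
  where
  open ≡-Reasoning
  off-diagonal : ∀ j → j ≢ i → identity i j *ℰ A j k ≡ 0ℰ
  off-diagonal j j≢i = trans (cong (_*ℰ A j k) (identity-offDiagonal (j≢i ∘ sym))) (zeroˡ (A j k))

⊗-identityʳ : ∀ {m n} (A : Matrix m n) → A ⊗ identity ≐ A
⊗-identityʳ A i k = begin
  (A ⊗ identity) i k                   ≡⟨ ⊗-entry A identity i k ⟩
  sum (λ j → A i j *ℰ identity j k)    ≡⟨ sum-single k off-diagonal ⟩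
  A i k *ℰ identity k k                ≡⟨ cong (A i k *ℰ_) (identity-diagonal k) ⟩
  A i k *ℰ 1ℰ                          ≡⟨ *-identityʳ (A i k) ⟩
  A i k                                ∎
  where
  open ≡-Reasoning
  off-diagonal : ∀ j → j ≢ k → A i j *ℰ identity j k ≡ 0ℰ
  off-diagonal j j≢k = trans (cong (A i j *ℰ_) (identity-offDiagonal j≢k)) (zeroʳ (A i j))

ᴴ-cong : ∀ {m n} {A B : Matrix m n} → A ≐ B → A ᴴ ≐ B ᴴ
ᴴ-cong A≐B i j = cong conj (A≐B j i)

ᴴ-⊗ : ∀ {m n p} (A : Matrix m n) (B : Matrix n p) → (A ⊗ B) ᴴ ≐ B ᴴ ⊗ A ᴴ
ᴴ-⊗ A B i k = begin
  conj ((A ⊗ B) k i)                           ≡⟨ cong conj (⊗-entry A B k i) ⟩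
  conj (sum (λ j → A k j *ℰ B j i))            ≡⟨ conj-sum (λ j → A k j *ℰ B j i) ⟩
  sum (λ j → conj (A k j *ℰ B j i))            ≡⟨ sum-cong-≗ conj-term ⟩
  sum (λ j → conj (B j i) *ℰ conj (A k j))     ≡⟨ ⊗-entry (B ᴴ) (A ᴴ) i k ⟨
  (B ᴴ ⊗ A ᴴ) i k                              ∎
  where
  open ≡-Reasoning
  conj-term : ∀ j → conj (A k j *ℰ B j i) ≡ conj (B j i) *ℰ conj (A k j)
  conj-term j = trans (conj-* (A k j) (B j i)) (*-comm (conj (A k j)) (conj (B j i)))

module TwoSidedEquivalence {c ℓ} (M : Monoid c ℓ) where
  open Monoid M
    using (Carrier; _≈_; _∙_; ε; assoc; identityˡ; identityʳ; ∙-congˡ; ∙-congʳ; setoid)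
    renaming (refl to ≈-refl; trans to ≈-trans)
  open MonoidProperties M using (cancelˡ; cancelʳ; cancelᶜ)
  open SetoidReasoning setoid

  IsUnit : Carrier → Set _
  IsUnit a = Σ Carrier λ b → (a ∙ b ≈ ε) × (b ∙ a ≈ ε)

  IsUnit-ε : IsUnit ε
  IsUnit-ε = ε , identityˡ ε , identityˡ ε

  IsUnit-∙ : ∀ {a b} → IsUnit a → IsUnit b → IsUnit (a ∙ b)
  IsUnit-∙ {a} {b} (a⁻¹ , aa⁻¹≈ε , a⁻¹a≈ε) (b⁻¹ , bb⁻¹≈ε , b⁻¹b≈ε) =
    b⁻¹ ∙ a⁻¹ ,
    ≈-trans (cancelᶜ bb⁻¹≈ε a a⁻¹) aa⁻¹≈ε ,
    ≈-trans (cancelᶜ a⁻¹a≈ε b⁻¹ b) b⁻¹b≈ε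

  _∼_ : Carrier → Carrier → Set _
  x ∼ y = Σ Carrier λ p → Σ Carrier λ q → IsUnit p × IsUnit q × ((p ∙ x) ∙ q ≈ y)

  ∼-reflexive : ∀ {x y} → x ≈ y → x ∼ y
  ∼-reflexive {x} {y} x≈y = ε , ε , IsUnit-ε , IsUnit-ε , (begin
    (ε ∙ x) ∙ ε   ≈⟨ identityʳ (ε ∙ x) ⟩
    ε ∙ x         ≈⟨ identityˡ x ⟩
    x             ≈⟨ x≈y ⟩
    y             ∎)

  ∼-sym : ∀ {x y} → x ∼ y → y ∼ x
  ∼-sym {x} {y} (p , q , (p⁻¹ , pp⁻¹≈ε , p⁻¹p≈ε) , (q⁻¹ , qq⁻¹≈ε , q⁻¹q≈ε) , pxq≈y) =
    p⁻¹ , q⁻¹ , (p , p⁻¹p≈ε , pp⁻¹≈ε) , (q , q⁻¹q≈ε , qq⁻¹≈ε) , (begin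
      (p⁻¹ ∙ y) ∙ q⁻¹                 ≈⟨ ∙-congʳ (∙-congˡ pxq≈y) ⟨
      (p⁻¹ ∙ ((p ∙ x) ∙ q)) ∙ q⁻¹     ≈⟨ ∙-congʳ (assoc p⁻¹ (p ∙ x) q) ⟨
      ((p⁻¹ ∙ (p ∙ x)) ∙ q) ∙ q⁻¹     ≈⟨ ∙-congʳ (∙-congʳ (cancelˡ p⁻¹p≈ε x)) ⟩
      (x ∙ q) ∙ q⁻¹                   ≈⟨ cancelʳ qq⁻¹≈ε x ⟩
      x                               ∎)

  ∼-trans : ∀ {x y z} → x ∼ y → y ∼ z → x ∼ z
  ∼-trans {x} {y} {z} (p , q , p-unit , q-unit , pxq≈y) (p′ , q′ , p′-unit , q′-unit , p′yq′≈z) =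
    p′ ∙ p , q ∙ q′ , IsUnit-∙ p′-unit p-unit , IsUnit-∙ q-unit q′-unit , (begin
      ((p′ ∙ p) ∙ x) ∙ (q ∙ q′)      ≈⟨ assoc ((p′ ∙ p) ∙ x) q q′ ⟨
      (((p′ ∙ p) ∙ x) ∙ q) ∙ q′      ≈⟨ ∙-congʳ (∙-congʳ (assoc p′ p x)) ⟩
      ((p′ ∙ (p ∙ x)) ∙ q) ∙ q′      ≈⟨ ∙-congʳ (assoc p′ (p ∙ x) q) ⟩
      (p′ ∙ ((p ∙ x) ∙ q)) ∙ q′      ≈⟨ ∙-congʳ (∙-congˡ pxq≈y) ⟩
      (p′ ∙ y) ∙ q′                  ≈⟨ p′yq′≈z ⟩
      z                              ∎)

  ∼-isEquivalence : IsEquivalence _∼_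
  ∼-isEquivalence = record
    { refl  = ∼-reflexive ≈-refl
    ; sym   = ∼-sym
    ; trans = ∼-trans
    }

⊗-monoid : ℕ → Monoid _ _
⊗-monoid n = record
  { Carrier  = Matrix n n
  ; _≈_      = _≐_
  ; _∙_      = _⊗_
  ; ε        = identity
  ; isMonoid = record
    { isSemigroup = record
      { isMagma = record { isEquivalence = ≐-isEquivalence ; ∙-cong = ⊗-cong }
      ; assoc   = ⊗-assoc
      }
    ; identity = ⊗-identityˡ , ⊗-identityʳ
    }
  }

-- In ⊗-monoid n, IsUnit is Invertible, and X ∼ diag d is IsSNF X d without its divisibility chain.
module _ {n : ℕ} where
  open TwoSidedEquivalence (⊗-monoid n) public using (_∼_; ∼-reflexive; ∼-sym; ∼-trans; ∼-isEquivalence)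

  IsSNF-resp : ∀ {X Y : Matrix n n} {d} → X ∼ Y → IsSNF Y d → IsSNF X d
  IsSNF-resp {X} {Y} {d} X∼Y (S , T , S-inv , T-inv , SYT≐D , divisibility) =
    let P , Q , P-inv , Q-inv , PXQ≐D = ∼-trans {X} {Y} {diag d} X∼Y (S , T , S-inv , T-inv , SYT≐D)
    in  P , Q , P-inv , Q-inv , PXQ≐D , divisibility

Invertible-ᴴ : ∀ {n} {A : Matrix n n} → Invertible A → Invertible (A ᴴ)
Invertible-ᴴ {A = A} (A⁻¹ , AA⁻¹≐I , A⁻¹A≐I) =
  A⁻¹ ᴴ , reverse A⁻¹ A A⁻¹A≐I , reverse A A⁻¹ AA⁻¹≐I
  where
  reverse : ∀ {n} (B C : Matrix n n) → B ⊗ C ≐ identity → C ᴴ ⊗ B ᴴ ≐ identity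
  reverse B C BC≐I = begin
    C ᴴ ⊗ B ᴴ       ≈⟨ ᴴ-⊗ B C ⟨
    (B ⊗ C) ᴴ       ≈⟨ ᴴ-cong BC≐I ⟩
    identity ᴴ      ≈⟨ identityᴴ ⟩
    identity        ∎
    where open SetoidReasoning (≐-setoid _ _)

gram : ∀ {m n} → Matrix m n → Matrix m m
gram A = A ⊗ A ᴴ

gram-cong : ∀ {m n} {A B : Matrix m n} → A ≐ B → gram A ≐ gram B
gram-cong A≐B = ⊗-cong A≐B (ᴴ-cong A≐B)

gram-⊗ : ∀ {m n} (E : Matrix m m) (A : Matrix m n) → gram (E ⊗ A) ≐ (E ⊗ gram A) ⊗ E ᴴ
gram-⊗ E A = begin
  (E ⊗ A) ⊗ (E ⊗ A) ᴴ          ≈⟨ ⊗-cong {A = E ⊗ A} (λ _ _ → refl) (ᴴ-⊗ E A) ⟩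
  (E ⊗ A) ⊗ (A ᴴ ⊗ E ᴴ)        ≈⟨ ⊗-assoc (E ⊗ A) (A ᴴ) (E ᴴ) ⟨
  ((E ⊗ A) ⊗ A ᴴ) ⊗ E ᴴ        ≈⟨ ⊗-cong {B = E ᴴ} (⊗-assoc E A (A ᴴ)) (λ _ _ → refl) ⟩
  (E ⊗ (A ⊗ A ᴴ)) ⊗ E ᴴ        ∎
  where open SetoidReasoning (≐-setoid _ _)

gram-rowOperation : ∀ {m n} (A B : Matrix m n) (E : Matrix m m) →
                    Invertible E → B ≐ E ⊗ A → gram A ∼ gram B
gram-rowOperation A B E E-inv B≐EA = E , E ᴴ , E-inv , Invertible-ᴴ E-inv , (begin
  (E ⊗ gram A) ⊗ E ᴴ    ≈⟨ gram-⊗ E A ⟨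
  gram (E ⊗ A)          ≈⟨ gram-cong B≐EA ⟨
  gram B                ∎)
  where open SetoidReasoning (≐-setoid _ _)

gram-columnPermutation : ∀ {m n} (A B : Matrix m n) (π : Permutation n n) →
  (∀ k l c → A k (π ⟨$⟩ʳ c) *ℰ conj (A l (π ⟨$⟩ʳ c)) ≡ B k c *ℰ conj (B l c)) →
  gram A ≐ gram B
gram-columnPermutation A B π same-terms k l = begin
  gram A k l                                           ≡⟨ ⊗-entry A (A ᴴ) k l ⟩
  sum (λ c → A k c *ℰ conj (A l c))                    ≡⟨ sum-permute (λ c → A k c *ℰ conj (A l c)) π ⟩
  sum (λ c → A k (π ⟨$⟩ʳ c) *ℰ conj (A l (π ⟨$⟩ʳ c)))  ≡⟨ sum-cong-≗ (same-terms k l) ⟩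
  sum (λ c → B k c *ℰ conj (B l c))                    ≡⟨ ⊗-entry B (B ᴴ) k l ⟨
  gram B k l                                           ∎
  where open ≡-Reasoning

gram-scaleCol : ∀ {m n} j u (A : Matrix m n) → u *ℰ conj u ≡ 1ℰ → gram A ≐ gram (scaleCol j u A)
gram-scaleCol j u A uū≡1 = gram-columnPermutation A (scaleCol j u A) Perm.id same-terms
  where
  same-terms : ∀ k l c → A k c *ℰ conj (A l c) ≡ scaleCol j u A k c *ℰ conj (scaleCol j u A l c)
  same-terms k l c with c ≟ j
  ... | no _  = refl
  ... | yes _ = sym (begin
    (A k c *ℰ u) *ℰ conj (A l c *ℰ u)          ≡⟨ cong ((A k c *ℰ u) *ℰ_) (conj-* (A l c) u) ⟩
    (A k c *ℰ u) *ℰ (conj (A l c) *ℰ conj u)   ≡⟨ regroup (A k c) (conj (A l c)) u (conj u) ⟩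
    (A k c *ℰ conj (A l c)) *ℰ (u *ℰ conj u)   ≡⟨ cong ((A k c *ℰ conj (A l c)) *ℰ_) uū≡1 ⟩
    (A k c *ℰ conj (A l c)) *ℰ 1ℰ              ≡⟨ *-identityʳ (A k c *ℰ conj (A l c)) ⟩
    A k c *ℰ conj (A l c)                      ∎)
    where
    open ≡-Reasoning
    regroup : ∀ a b x y → (a *ℰ x) *ℰ (b *ℰ y) ≡ (a *ℰ b) *ℰ (x *ℰ y)
    regroup a b x y = solve (a ∷ b ∷ x ∷ y ∷ []) ℰ-ring

swapFin≗transpose : ∀ {n} (i j k : Fin n) → swapFin i j k ≡ PermComponents.transpose i j k
swapFin≗transpose i j k with k ≟ i
... | yes _ = refl
... | no _ with k ≟ j
...   | yes _ = refl
...   | no _  = refl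

gram-swapCols : ∀ {m n} j j′ (A : Matrix m n) → gram A ≐ gram (swapCols j j′ A)
gram-swapCols j j′ A = gram-columnPermutation A (swapCols j j′ A) (Perm.transpose j j′)
  λ k l c → cong (λ c′ → A k c′ *ℰ conj (A l c′)) (sym (swapFin≗transpose j j′ c))

scaleRow-as-⊗ : ∀ {m n} i u (A : Matrix m n) → scaleRow i u A ≐ scaleRow i u identity ⊗ A
scaleRow-as-⊗ i u A k l with k ≟ i
... | no _  = sym (⊗-identityˡ A k l)
... | yes _ = begin
  u *ℰ A k l                                     ≡⟨ cong (u *ℰ_) (⊗-identityˡ A k l) ⟨
  u *ℰ (identity ⊗ A) k l                        ≡⟨ cong (u *ℰ_) (⊗-entry identity A k l) ⟩
  u *ℰ sum (λ c → identity k c *ℰ A c l)         ≡⟨ *-distribˡ-sum u (λ c → identity k c *ℰ A c l) ⟩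
  sum (λ c → u *ℰ (identity k c *ℰ A c l))       ≡⟨ sum-cong-≗ (λ c → *-assoc u (identity k c) (A c l)) ⟨
  sum (λ c → (u *ℰ identity k c) *ℰ A c l)       ≡⟨ sumℰ≡sum (λ c → (u *ℰ identity k c) *ℰ A c l) ⟨
  sumℰ (λ c → (u *ℰ identity k c) *ℰ A c l)      ∎
  where open ≡-Reasoning

scaleRow-on : ∀ {m n} {i k} u (A : Matrix m n) l → k ≡ i → scaleRow i u A k l ≡ u *ℰ A k l
scaleRow-on {i = i} {k} u A l k≡i with k ≟ i
... | yes _   = refl
... | no k≢i = contradiction k≡i k≢i

scaleRow-off : ∀ {m n} {i k} u (A : Matrix m n) l → k ≢ i → scaleRow i u A k l ≡ A k l
scaleRow-off {i = i} {k} u A l k≢i with k ≟ i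
... | yes k≡i = contradiction k≡i k≢i
... | no _    = refl

scaleRow-scaleRow : ∀ {m n} i {u v} (A : Matrix m n) → u *ℰ v ≡ 1ℰ → scaleRow i u (scaleRow i v A) ≐ A
scaleRow-scaleRow i {u} {v} A uv≡1 k l = by-cases (k ≟ i)
  where
  open ≡-Reasoning
  by-cases : Dec (k ≡ i) → scaleRow i u (scaleRow i v A) k l ≡ A k l
  by-cases (no k≢i)  = trans (scaleRow-off u (scaleRow i v A) l k≢i) (scaleRow-off v A l k≢i)
  by-cases (yes k≡i) = begin
    scaleRow i u (scaleRow i v A) k l  ≡⟨ scaleRow-on u (scaleRow i v A) l k≡i ⟩
    u *ℰ scaleRow i v A k l            ≡⟨ cong (u *ℰ_) (scaleRow-on v A l k≡i) ⟩
    u *ℰ (v *ℰ A k l)                  ≡⟨ *-assoc u v (A k l) ⟨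
    (u *ℰ v) *ℰ A k l                  ≡⟨ cong (_*ℰ A k l) uv≡1 ⟩
    1ℰ *ℰ A k l                        ≡⟨ *-identityˡ (A k l) ⟩
    A k l                              ∎

Invertible-scaleRow : ∀ {m} (i : Fin m) {u v} → u *ℰ v ≡ 1ℰ → Invertible (scaleRow i u identity)
Invertible-scaleRow i {u} {v} uv≡1 =
  scaleRow i v identity , cancel uv≡1 , cancel (trans (*-comm v u) uv≡1)
  where
  cancel : ∀ {x y} → x *ℰ y ≡ 1ℰ → scaleRow i x identity ⊗ scaleRow i y identity ≐ identity
  cancel {x} {y} xy≡1 k l =
    trans (sym (scaleRow-as-⊗ i x (scaleRow i y identity) k l)) (scaleRow-scaleRow i identity xy≡1 k l)

permutationMatrix : ∀ {m} → Permutation m m → Matrix m m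
permutationMatrix π k = identity (π ⟨$⟩ʳ k)

permutationMatrix-⊗ : ∀ {m n} (π : Permutation m m) (A : Matrix m n) →
                      permutationMatrix π ⊗ A ≐ λ k → A (π ⟨$⟩ʳ k)
permutationMatrix-⊗ π A k = ⊗-identityˡ A (π ⟨$⟩ʳ k)

Invertible-permutationMatrix : ∀ {m} (π : Permutation m m) → Invertible (permutationMatrix π)
Invertible-permutationMatrix π =
  permutationMatrix (Perm.flip π) ,
  (λ k l → trans (permutationMatrix-⊗ π (permutationMatrix (Perm.flip π)) k l)
                 (cong (λ r → identity r l) (Perm.inverseˡ π))) ,
  (λ k l → trans (permutationMatrix-⊗ (Perm.flip π) (permutationMatrix π) k l)
                 (cong (λ r → identity r l) (Perm.inverseʳ π)))

swapRows-as-⊗ : ∀ {m n} i i′ (A : Matrix m n) → swapRows i i′ A ≐ permutationMatrix (Perm.transpose i i′) ⊗ A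
swapRows-as-⊗ i i′ A k l =
  sym (trans (permutationMatrix-⊗ (Perm.transpose i i′) A k l)
             (cong (λ r → A r l) (sym (swapFin≗transpose i i′ k))))

addRow : ∀ {m} → Fin m → (Fin m → ℰ) → Matrix m m
addRow i w k l = identity k l +ℰ w k *ℰ identity i l

addRow-⊗ : ∀ {m n} i w (X : Matrix m n) k l → (addRow i w ⊗ X) k l ≡ X k l +ℰ w k *ℰ X i l
addRow-⊗ i w X k l = begin
  (addRow i w ⊗ X) k l
    ≡⟨ ⊗-entry (addRow i w) X k l ⟩
  sum (λ c → (identity k c +ℰ w k *ℰ identity i c) *ℰ X c l)
    ≡⟨ sum-cong-≗ distribute ⟩
  sum (λ c → identity k c *ℰ X c l +ℰ w k *ℰ (identity i c *ℰ X c l))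
    ≡⟨ ∑-distrib-+ (λ c → identity k c *ℰ X c l) (λ c → w k *ℰ (identity i c *ℰ X c l)) ⟩
  sum (λ c → identity k c *ℰ X c l) +ℰ sum (λ c → w k *ℰ (identity i c *ℰ X c l))
    ≡⟨ cong (sum (λ c → identity k c *ℰ X c l) +ℰ_) (*-distribˡ-sum (w k) (λ c → identity i c *ℰ X c l)) ⟨
  sum (λ c → identity k c *ℰ X c l) +ℰ w k *ℰ sum (λ c → identity i c *ℰ X c l)
    ≡⟨ cong₂ (λ x y → x +ℰ w k *ℰ y) (⊗-entry identity X k l) (⊗-entry identity X i l) ⟨
  (identity ⊗ X) k l +ℰ w k *ℰ (identity ⊗ X) i l
    ≡⟨ cong₂ (λ x y → x +ℰ w k *ℰ y) (⊗-identityˡ X k l) (⊗-identityˡ X i l) ⟩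
  X k l +ℰ w k *ℰ X i l
    ∎
  where
  open ≡-Reasoning
  distribute : ∀ c → (identity k c +ℰ w k *ℰ identity i c) *ℰ X c l
                   ≡ identity k c *ℰ X c l +ℰ w k *ℰ (identity i c *ℰ X c l)
  distribute c = trans (distribʳ (X c l) (identity k c) (w k *ℰ identity i c))
                       (cong (identity k c *ℰ X c l +ℰ_) (*-assoc (w k) (identity i c) (X c l)))

addRow-⊗-addRow : ∀ {m} (i : Fin m) w w′ →
  addRow i w ⊗ addRow i w′ ≐ addRow i (λ k → w′ k +ℰ w k +ℰ w k *ℰ w′ i)
addRow-⊗-addRow i w w′ k l =
  trans (addRow-⊗ i w (addRow i w′) k l) (regroup (identity k l) (identity i l) (w′ k) (w k) (w′ i))
  where
  regroup : ∀ a b x y z → (a +ℰ x *ℰ b) +ℰ y *ℰ (b +ℰ z *ℰ b) ≡ a +ℰ (x +ℰ y +ℰ y *ℰ z) *ℰ b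
  regroup a b x y z = solve (a ∷ b ∷ x ∷ y ∷ z ∷ []) ℰ-ring

addRow-zero : ∀ {m} (i : Fin m) w → (∀ k → w k ≡ 0ℰ) → addRow i w ≐ identity
addRow-zero i w w≡0 k l = begin
  identity k l +ℰ w k *ℰ identity i l   ≡⟨ cong (λ x → identity k l +ℰ x *ℰ identity i l) (w≡0 k) ⟩
  identity k l +ℰ 0ℰ *ℰ identity i l    ≡⟨ cong (identity k l +ℰ_) (zeroˡ (identity i l)) ⟩
  identity k l +ℰ 0ℰ                    ≡⟨ +-identityʳ (identity k l) ⟩
  identity k l                          ∎
  where open ≡-Reasoning

Invertible-addRow : ∀ {m} (i : Fin m) s u → s *ℰ (1ℰ +ℰ u i) ≡ -ℰ 1ℰ →
                    Invertible (addRow i (λ k → s *ℰ u k))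
Invertible-addRow i s u s[1+uᵢ]≡-1 =
  addRow i u ,
  (λ k l → trans (addRow-⊗-addRow i (λ k → s *ℰ u k) u k l)
                 (addRow-zero i _ (λ k → trans (factor₁ (u k) (u i)) (vanishes (u k))) k l)) ,
  (λ k l → trans (addRow-⊗-addRow i u (λ k → s *ℰ u k) k l)
                 (addRow-zero i _ (λ k → trans (factor₂ (u k) (u i)) (vanishes (u k))) k l))
  where
  factor₁ : ∀ x y → x +ℰ s *ℰ x +ℰ s *ℰ x *ℰ y ≡ x *ℰ (1ℰ +ℰ s *ℰ (1ℰ +ℰ y))
  factor₁ x y = solve (x ∷ y ∷ s ∷ []) ℰ-ring
  factor₂ : ∀ x y → s *ℰ x +ℰ x +ℰ x *ℰ (s *ℰ y) ≡ x *ℰ (1ℰ +ℰ s *ℰ (1ℰ +ℰ y))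
  factor₂ x y = solve (x ∷ y ∷ s ∷ []) ℰ-ring
  vanishes : ∀ x → x *ℰ (1ℰ +ℰ s *ℰ (1ℰ +ℰ u i)) ≡ 0ℰ
  vanishes x = trans (cong (λ t → x *ℰ (1ℰ +ℰ t)) s[1+uᵢ]≡-1) (solve (x ∷ []) ℰ-ring)

-- Pivoting on A i j = c with c v = 1 is left multiplication by I - v (aⱼ - eᵢ) eᵢᵀ,
-- where aⱼ is column j of A.
module _ {m n} (A : Matrix m n) (i : Fin m) (j : Fin n) where

  pivotColumn : Fin m → ℰ
  pivotColumn k = A k j -ℰ identity k i

  pivotMatrix : ℰ → Matrix m m
  pivotMatrix v = addRow i (λ k → (-ℰ v) *ℰ pivotColumn k)

  Invertible-pivotMatrix : ∀ {v} → A i j *ℰ v ≡ 1ℰ → Invertible (pivotMatrix v)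
  Invertible-pivotMatrix {v} A-ij*v≡1 = Invertible-addRow i (-ℰ v) pivotColumn (begin
    (-ℰ v) *ℰ (1ℰ +ℰ (A i j -ℰ identity i i))  ≡⟨ cong (λ t → (-ℰ v) *ℰ (1ℰ +ℰ (A i j -ℰ t)))
                                                     (identity-diagonal i) ⟩
    (-ℰ v) *ℰ (1ℰ +ℰ (A i j -ℰ 1ℰ))            ≡⟨ cancel-one (A i j) ⟩
    -ℰ (A i j *ℰ v)                             ≡⟨ cong -ℰ_ A-ij*v≡1 ⟩
    -ℰ 1ℰ                                       ∎)
    where
    open ≡-Reasoning
    cancel-one : ∀ c → (-ℰ v) *ℰ (1ℰ +ℰ (c -ℰ 1ℰ)) ≡ -ℰ (c *ℰ v)
    cancel-one c = solve (c ∷ v ∷ []) ℰ-ring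

  pivot-row : ∀ {B v} → A i j *ℰ v ≡ 1ℰ → IsPivot A i j B → ∀ l → B i l ≡ v *ℰ A i l
  pivot-row {B} {v} A-ij*v≡1 (_ , pivot-row-scaled , _) l = begin
    B i l                       ≡⟨ *-identityˡ (B i l) ⟨
    1ℰ *ℰ B i l                 ≡⟨ cong (_*ℰ B i l) A-ij*v≡1 ⟨
    (A i j *ℰ v) *ℰ B i l       ≡⟨ swap-assoc (A i j) v (B i l) ⟩
    v *ℰ (A i j *ℰ B i l)       ≡⟨ cong (v *ℰ_) (pivot-row-scaled l) ⟩
    v *ℰ A i l                  ∎
    where
    open ≡-Reasoning
    swap-assoc : ∀ x y z → (x *ℰ y) *ℰ z ≡ y *ℰ (x *ℰ z)
    swap-assoc x y z = solve (x ∷ y ∷ z ∷ []) ℰ-ring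

  pivot-as-⊗ : ∀ {B v} → A i j *ℰ v ≡ 1ℰ → IsPivot A i j B → B ≐ pivotMatrix v ⊗ A
  pivot-as-⊗ {B} {v} A-ij*v≡1 A⇝B@(_ , _ , other-rows) k l =
    trans (row k (k ≟ i)) (sym (addRow-⊗ i (λ k → (-ℰ v) *ℰ pivotColumn k) A k l))
    where
    open ≡-Reasoning
    other-row : ∀ a b x → a -ℰ b *ℰ (v *ℰ x) ≡ a +ℰ ((-ℰ v) *ℰ (b -ℰ 0ℰ)) *ℰ x
    other-row a b x = solve (a ∷ b ∷ x ∷ v ∷ []) ℰ-ring
    unit-row : ∀ a c → c *ℰ v ≡ 1ℰ → v *ℰ a ≡ a +ℰ ((-ℰ v) *ℰ (c -ℰ 1ℰ)) *ℰ a
    unit-row a c cv≡1 = begin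
      v *ℰ a                                ≡⟨ solve (a ∷ v ∷ []) ℰ-ring ⟩
      v *ℰ a +ℰ (1ℰ -ℰ 1ℰ) *ℰ a             ≡⟨ cong (λ t → v *ℰ a +ℰ (1ℰ -ℰ t) *ℰ a) cv≡1 ⟨
      v *ℰ a +ℰ (1ℰ -ℰ c *ℰ v) *ℰ a         ≡⟨ solve (a ∷ c ∷ v ∷ []) ℰ-ring ⟩
      a +ℰ ((-ℰ v) *ℰ (c -ℰ 1ℰ)) *ℰ a       ∎
    row : ∀ k → Dec (k ≡ i) → B k l ≡ A k l +ℰ ((-ℰ v) *ℰ pivotColumn k) *ℰ A i l
    row k (yes refl) = begin
      B i l                                          ≡⟨ pivot-row A-ij*v≡1 A⇝B l ⟩
      v *ℰ A i l                                     ≡⟨ unit-row (A i l) (A i j) A-ij*v≡1 ⟩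
      A i l +ℰ ((-ℰ v) *ℰ (A i j -ℰ 1ℰ)) *ℰ A i l   ≡⟨ cong (λ t → A i l +ℰ ((-ℰ v) *ℰ (A i j -ℰ t)) *ℰ A i l)
                                                             (identity-diagonal i) ⟨
      A i l +ℰ ((-ℰ v) *ℰ pivotColumn i) *ℰ A i l    ∎
    row k (no k≢i) = begin
      B k l                                          ≡⟨ other-rows k k≢i l ⟩
      A k l -ℰ A k j *ℰ B i l                        ≡⟨ cong (λ t → A k l -ℰ A k j *ℰ t)
                                                             (pivot-row A-ij*v≡1 A⇝B l) ⟩
      A k l -ℰ A k j *ℰ (v *ℰ A i l)                 ≡⟨ other-row (A k l) (A k j) (A i l) ⟩
      A k l +ℰ ((-ℰ v) *ℰ (A k j -ℰ 0ℰ)) *ℰ A i l   ≡⟨ cong (λ t → A k l +ℰ ((-ℰ v) *ℰ (A k j -ℰ t)) *ℰ A i l)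
                                                             (identity-offDiagonal k≢i) ⟨
      A k l +ℰ ((-ℰ v) *ℰ pivotColumn k) *ℰ A i l    ∎

entry-inℍ : ∀ {m n} {A : Matrix m n} → IsℍMatrix A → ∀ i j → Inℍ (A i j)
entry-inℍ {A = A} A-ℍ i j =
  subst Inℍ (det-1×1 (A i j)) (A-ℍ 1 (λ _ → i) (λ _ → j) from-Fin1-injective from-Fin1-injective)
  where
  det-1×1 : ∀ x → det (λ (_ _ : Fin 1) → x) ≡ x
  det-1×1 x = trans (+-identityʳ (1ℰ *ℰ x *ℰ 1ℰ)) (trans (*-identityʳ (1ℰ *ℰ x)) (*-identityˡ x))
  from-Fin1-injective : ∀ {A : Set} {a : A} → Injective _≡_ _≡_ (λ (_ : Fin 1) → a)
  from-Fin1-injective {x = zero} {zero} _ = refl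

nonzero-inℍ⇒sixthRoot : ∀ {x} → Inℍ x → x ≢ 0ℰ → x ^ℰ 6 ≡ 1ℰ
nonzero-inℍ⇒sixthRoot (inj₁ x⁶≡1) _   = x⁶≡1
nonzero-inℍ⇒sixthRoot (inj₂ x≡0)  x≢0 = contradiction x≡0 x≢0

-- Implicit matrices are given explicitly throughout: _≐_ and _⊗_ unfold to arithmetic on
-- the components of ℰ, where unification cannot recover them.  A sixth root of unity u
-- has inverse u ^ℰ 5, since u ^ℰ 6 unfolds to u *ℰ u ^ℰ 5.
gram-step : ∀ {m n} {A B : Matrix m n} → ℍStep A B → gram A ∼ gram B
gram-step (_ , _ , rowScale A i u u⁶≡1) =
  gram-rowOperation A (scaleRow i u A) (scaleRow i u identity)
    (Invertible-scaleRow i {u} {u ^ℰ 5} u⁶≡1) (scaleRow-as-⊗ i u A)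
gram-step (_ , _ , colScale A j u u⁶≡1) =
  ∼-reflexive {x = gram A} {gram (scaleCol j u A)}
    (gram-scaleCol j u A (unit⇒*-conj≡1 {u} {u ^ℰ 5} u⁶≡1))
gram-step (_ , _ , rowSwap A i i′) =
  gram-rowOperation A (swapRows i i′ A) (permutationMatrix (Perm.transpose i i′))
    (Invertible-permutationMatrix (Perm.transpose i i′)) (swapRows-as-⊗ i i′ A)
gram-step (_ , _ , colSwap A j j′) =
  ∼-reflexive {x = gram A} {gram (swapCols j j′ A)} (gram-swapCols j j′ A)
gram-step (A-ℍ , _ , pivot A i j B A⇝B) =
  gram-rowOperation A B (pivotMatrix A i j v)
    (Invertible-pivotMatrix A i j {v} A-ij*v≡1) (pivot-as-⊗ A i j {B} {v} A-ij*v≡1 A⇝B)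
  where
  v = A i j ^ℰ 5
  A-ij*v≡1 : A i j *ℰ v ≡ 1ℰ
  A-ij*v≡1 = nonzero-inℍ⇒sixthRoot {A i j} (entry-inℍ {A = A} A-ℍ i j) (proj₁ A⇝B)

gram-equivalent : ∀ {r n} {M₁ M₂ : Matrix r n} → Equivalentℍ M₁ M₂ → gram M₁ ∼ gram M₂
gram-equivalent {r} {n} = gfold ∼-isEquivalence gram (λ {A} {B} → gram-step {r} {n} {A} {B})

lemma3p9 : ∀ {r n} (M₁ M₂ : Matrix r n) →
    IsℍMatrix M₁ → IsℍMatrix M₂ → Equivalentℍ M₁ M₂ →
    ∀ (d : Fin r → ℰ) → IsSNF (M₁ ⊗ (M₁ ᴴ)) d ⇔ IsSNF (M₂ ⊗ (M₂ ᴴ)) d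
lemma3p9 M₁ M₂ _ _ M₁≈M₂ d =
  mk⇔ (IsSNF-resp {X = gram M₂} {gram M₁} {d} (∼-sym {x = gram M₁} {gram M₂} gram₁∼gram₂))
      (IsSNF-resp {X = gram M₁} {gram M₂} {d} gram₁∼gram₂)
  where
  gram₁∼gram₂ : gram M₁ ∼ gram M₂
  gram₁∼gram₂ = gram-equivalent M₁≈M₂
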